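{- There is no distance-regular graph with intersection array $\{135,128,16;1,16,120\}$.
   Context: A connected graph $\Gamma$ of diameter $d$ is distance-regular if there are constants $p^h_{ij}$ ($0\le h,i,j\le d$) such that for any two vertices $u,v$ at distance $h$, the number of vertices at distance $i$ from $u$ and distance $j$ from $v$ is $p^h_{ij}$. Its intersection array is $\{b_0,b_1,\dots,b_{d-1};c_1,c_2,\dots,c_d\}$ where $b_i=p^i_{1,i+1}$ and $c_{i+1}=p^{i+1}_{1,i}$. -}

module Defs where

open import Data.Nat using (ℕ; zero; suc; _+_)
open import Data.Bool using (Bool; true; false; _∧_; _∨_; not; if_then_else_)
open import Data.Fin using (Fin; toℕ) renaming (zero to fz; suc to fs)
open import Data.Fin.Properties using (_≟_)
open import Data.Product using (Σ; _×_; ∃-syntax)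
open import Relation.Nullary.Decidable using (⌊_⌋)
open import Relation.Binary.PropositionalEquality using (_≡_)

record Graph : Set where
  field
    n      : ℕ
    adj    : Fin n → Fin n → Bool
    adj-sym    : ∀ u v → adj u v ≡ adj v u
    adj-irrefl : ∀ u → adj u u ≡ false

anyFin : ∀ {m} → (Fin m → Bool) → Bool
anyFin {zero}  f = false
anyFin {suc m} f = f fz ∨ anyFin (λ i → f (fs i))

countFin : ∀ {m} → (Fin m → Bool) → ℕ
countFin {zero}  f = 0
countFin {suc m} f = (if f fz then 1 else 0) + countFin (λ i → f (fs i))

module _ (Γ : Graph) where
  open Graph Γ

  -- within k u v = true  iff  d(u,v) ≤ k
  within : ℕ → Fin n → Fin n → Bool
  within zero    u v = ⌊ u ≟ v ⌋
  within (suc k) u v = within k u v ∨ anyFin (λ w → adj u w ∧ within k w v)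

  atDist : ℕ → Fin n → Fin n → Bool
  atDist zero    u v = within zero u v
  atDist (suc k) u v = within (suc k) u v ∧ not (within k u v)

  ConnectedDiameter : ℕ → Set
  ConnectedDiameter d =
    (∀ u v → within d u v ≡ true) × (∃[ u ] ∃[ v ] atDist d u v ≡ true)

  pCount : ℕ → ℕ → Fin n → Fin n → ℕ
  pCount i j u v = countFin (λ w → atDist i u w ∧ atDist j v w)

  DRGWithArray : (d : ℕ) → (b : Fin d → ℕ) → (c : Fin d → ℕ) → Set
  DRGWithArray d b c =
    ConnectedDiameter d ×
    Σ (ℕ → ℕ → ℕ → ℕ) λ p →
      (∀ h i j → h Data.Nat.≤ d → i Data.Nat.≤ d → j Data.Nat.≤ d →
        ∀ u v → atDist h u v ≡ true → pCount i j u v ≡ p h i j) ×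
      (∀ (i : Fin d) → b i ≡ p (toℕ i) 1 (suc (toℕ i))) ×
      (∀ (i : Fin d) → c i ≡ p (suc (toℕ i)) 1 (toℕ i))

module Submission where

-- Proof (vanishing Krein parameter + triple intersection numbers).  Write d for the
-- graph distance and A_j for the distance-j matrices, acting on integer vectors.
-- (1) From the array one reads off p^h_{1j}; the recurrence A A_j = Σ_h p^h_{1j} A_h
--     shows that an eigenvector of A_1 is a common eigenvector of all A_j.  Applied to
--     the all-ones vector this gives the valencies (1,135,1080,144); applied to the
--     vectors E_y = F(d(y,·)), F = (27,-5,1,-3), it gives the eigenvalue θ = -25.
-- (2) The E_y have Gram matrix 240 E and Σ_a E_ya³ = Σ_j k_j F_j³ = 0 (the Krein
--     parameter q^θ_{θθ} vanishes).  A general sum-of-squares identity then forces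
--     Σ_x E_xa E_xb E_xc = 0 for all vertices a, b, c.
-- (3) For a triangle u, v, w, the pointwise identity 3 F_r F_s F_t + 24 (27 [r=s=t=1] +
--     8 [r=s=t=3]) = G_rs + G_rt + G_st on distance triples, summed over all vertices
--     with the edge numbers p^1_{rs}, yields 27 N₁ + 8 N₃ = 71 in natural numbers,
--     which is impossible.

open import Defs
open import Data.Empty using (⊥; ⊥-elim)
open import Data.Bool using (Bool; true; false; _∧_; _∨_; not; if_then_else_)
open import Data.Fin using (Fin; toℕ; fromℕ<) renaming (zero to fz; suc to fs)
open import Data.Fin.Patterns using (0F; 1F; 2F; 3F)
open import Data.Fin.Properties using (_≟_; toℕ-injective; toℕ-fromℕ<; toℕ≤pred[n]; all?)
open import Data.Nat as ℕ using (ℕ; zero; suc; z≤n; s≤s)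
open import Data.Nat.Divisibility using (divides; _∣?_)
open import Data.Vec.Functional using (fromList)
open import Data.List using (_∷_; [])
import Data.Nat.Properties as ℕP
open import Data.Integer using (ℤ; +_; -[1+_]; 0ℤ; 1ℤ; _+_; _*_; _-_; -_; _≤_; +≤+)
open import Data.Integer.Properties
  using (+-*-semiring; +-identityˡ; +-identityʳ; *-identityˡ; *-identityʳ; *-zeroˡ; *-zeroʳ; *-comm; *-assoc; +-mono-≤; pos-+; pos-*; +-injective; i≡j⇒i-j≡0; *-cancelˡ-≡; *-cancelʳ-≡)
  renaming (_≟_ to _≟ℤ_)
open import Algebra.Properties.Semiring.Sum +-*-semiring
  using (sum; sum-cong-≗; ∑-comm; ∑-distrib-+; *-distribˡ-sum; *-distribʳ-sum; sum-replicate-zero)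
open import Data.Integer.Tactic.RingSolver using (solve-∀)
open import Data.Product using (Σ-syntax; _×_; _,_; proj₁; proj₂; ∃-syntax)
open import Data.Sum using (_⊎_; inj₁; inj₂)
open import Function using (_∘_)
open import Relation.Nullary using (yes; no; ¬_; Dec)
open import Relation.Nullary.Decidable using (⌊_⌋; _×-dec_; _→-dec_; toWitness; toWitnessFalse; False)
open import Relation.Binary.PropositionalEquality

⟦_⟧ : Bool → ℤ
⟦ true ⟧  = 1ℤ
⟦ false ⟧ = 0ℤ

⟦∧⟧ : ∀ a b → ⟦ a ∧ b ⟧ ≡ ⟦ a ⟧ * ⟦ b ⟧
⟦∧⟧ true  b = sym (*-identityˡ ⟦ b ⟧)
⟦∧⟧ false b = sym (*-zeroˡ ⟦ b ⟧)

δ : ∀ {m} → Fin m → Fin m → ℤ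
δ i j = ⟦ ⌊ i ≟ j ⌋ ⟧

module _ {m : ℕ} where

  δ-diag : (i : Fin m) → δ i i ≡ 1ℤ
  δ-diag i with i ≟ i
  ... | yes _   = refl
  ... | no i≢i = ⊥-elim (i≢i refl)

  δ-off : {i j : Fin m} → i ≢ j → δ i j ≡ 0ℤ
  δ-off {i} {j} i≢j with i ≟ j
  ... | yes i≡j = ⊥-elim (i≢j i≡j)
  ... | no _    = refl

  δ-sym : (i j : Fin m) → δ i j ≡ δ j i
  δ-sym i j with i ≟ j
  ... | yes refl = sym (δ-diag i)
  ... | no i≢j   = sym (δ-off (i≢j ∘ sym))

  δ-nonneg : (i j : Fin m) → 0ℤ ≤ δ i j
  δ-nonneg i j with i ≟ j
  ... | yes _ = +≤+ z≤n
  ... | no _  = +≤+ z≤n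

  δ-nonzero : {i j : Fin m} → δ i j ≢ 0ℤ → i ≡ j
  δ-nonzero {i} {j} δ≢0 with i ≟ j
  ... | yes i≡j = i≡j
  ... | no _    = ⊥-elim (δ≢0 refl)

  δ-idem : (i j : Fin m) → δ i j * δ i j ≡ δ i j
  δ-idem i j with i ≟ j
  ... | yes _ = refl
  ... | no _  = refl

  δ-subst : (g : Fin m → ℤ) (i j : Fin m) → δ i j * g j ≡ δ i j * g i
  δ-subst g i j with i ≟ j
  ... | yes refl = refl
  ... | no _     = trans (*-zeroˡ (g j)) (sym (*-zeroˡ (g i)))

δ-suc : ∀ {m} (i j : Fin m) → δ (fs i) (fs j) ≡ δ i j
δ-suc i j with i ≟ j
... | yes _ = refl
... | no _  = refl

sum-δ : ∀ {m} (i : Fin m) (g : Fin m → ℤ) → sum (λ j → δ i j * g j) ≡ g i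
sum-δ {suc m} fz g = begin
  1ℤ * g fz + sum (λ j → 0ℤ * g (fs j))
    ≡⟨ cong₂ _+_ (*-identityˡ (g fz)) (sum-cong-≗ (λ j → *-zeroˡ (g (fs j)))) ⟩
  g fz + sum {m} (λ _ → 0ℤ)
    ≡⟨ cong (λ z → g fz + z) (sum-replicate-zero m) ⟩
  g fz + 0ℤ
    ≡⟨ +-identityʳ (g fz) ⟩
  g fz ∎
  where open ≡-Reasoning
sum-δ {suc m} (fs i) g = begin
  0ℤ * g fz + sum (λ j → δ (fs i) (fs j) * g (fs j))
    ≡⟨ cong₂ _+_ (*-zeroˡ (g fz)) (sum-cong-≗ (λ j → cong (_* g (fs j)) (δ-suc i j))) ⟩
  0ℤ + sum (λ j → δ i j * g (fs j))
    ≡⟨ +-identityˡ _ ⟩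
  sum (λ j → δ i j * g (fs j))
    ≡⟨ sum-δ i (g ∘ fs) ⟩
  g (fs i) ∎
  where open ≡-Reasoning

count≡sum : ∀ {m} (f : Fin m → Bool) → + countFin f ≡ sum (λ i → ⟦ f i ⟧)
count≡sum {zero}  f = refl
count≡sum {suc m} f = begin
  + (indicator (f fz) ℕ.+ countFin (f ∘ fs))
    ≡⟨ pos-+ (indicator (f fz)) (countFin (f ∘ fs)) ⟩
  + indicator (f fz) + + countFin (f ∘ fs)
    ≡⟨ cong₂ _+_ (+indicator (f fz)) (count≡sum (f ∘ fs)) ⟩
  ⟦ f fz ⟧ + sum (λ i → ⟦ f (fs i) ⟧) ∎
  where
  open ≡-Reasoning
  indicator : Bool → ℕ
  indicator b = if b then 1 else 0
  +indicator : ∀ b → + indicator b ≡ ⟦ b ⟧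
  +indicator true  = refl
  +indicator false = refl

sum-nonneg : ∀ {m} (f : Fin m → ℤ) → (∀ i → 0ℤ ≤ f i) → 0ℤ ≤ sum f
sum-nonneg {zero}  f f≥0 = +≤+ z≤n
sum-nonneg {suc m} f f≥0 = +-mono-≤ (f≥0 fz) (sum-nonneg (f ∘ fs) (f≥0 ∘ fs))

nonneg-* : ∀ {a b} → 0ℤ ≤ a → 0ℤ ≤ b → 0ℤ ≤ a * b
nonneg-* (+≤+ {n = a} _) (+≤+ {n = b} _) = subst (0ℤ ≤_) (pos-* a b) (+≤+ z≤n)

nonneg-sum-zero : ∀ {a b} → 0ℤ ≤ a → 0ℤ ≤ b → a + b ≡ 0ℤ → a ≡ 0ℤ × b ≡ 0ℤ
nonneg-sum-zero (+≤+ {n = zero}  _) (+≤+ {n = zero} _) _  = refl , refl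
nonneg-sum-zero (+≤+ {n = zero}  _) (+≤+ {n = suc _} _) ()
nonneg-sum-zero (+≤+ {n = suc _} _) (+≤+ _)             ()

sum-zero : ∀ {m} (f : Fin m → ℤ) → (∀ i → 0ℤ ≤ f i) → sum f ≡ 0ℤ → ∀ i → f i ≡ 0ℤ
sum-zero {suc m} f f≥0 Σ≡0 fz     = proj₁ (nonneg-sum-zero (f≥0 fz) (sum-nonneg (f ∘ fs) (f≥0 ∘ fs)) Σ≡0)
sum-zero {suc m} f f≥0 Σ≡0 (fs i) =
  sum-zero (f ∘ fs) (f≥0 ∘ fs) (proj₂ (nonneg-sum-zero (f≥0 fz) (sum-nonneg (f ∘ fs) (f≥0 ∘ fs)) Σ≡0)) i

sum-witness : ∀ {m} (f : Fin m → ℤ) → sum f ≢ 0ℤ → ∃[ i ] f i ≢ 0ℤ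
sum-witness {zero}  f Σ≢0 = ⊥-elim (Σ≢0 refl)
sum-witness {suc m} f Σ≢0 with f fz ≟ℤ 0ℤ
... | no f0≢0 = fz , f0≢0
... | yes f0≡0 with sum-witness (f ∘ fs) (λ rest≡0 → Σ≢0 (cong₂ _+_ f0≡0 rest≡0))
...   | i , fi≢0 = fs i , fi≢0

square-nonneg : ∀ i → 0ℤ ≤ i * i
square-nonneg (+ zero)  = +≤+ z≤n
square-nonneg (+ suc _) = +≤+ z≤n
square-nonneg -[1+ _ ]  = +≤+ z≤n

square-zero : ∀ i → i * i ≡ 0ℤ → i ≡ 0ℤ
square-zero (+ zero) _ = refl

sum-sub : ∀ {m} (f g : Fin m → ℤ) → sum (λ i → f i - g i) ≡ sum f - sum g
sum-sub {zero}  f g = refl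
sum-sub {suc m} f g = begin
  (f fz - g fz) + sum (λ i → f (fs i) - g (fs i))
    ≡⟨ cong (λ z → (f fz - g fz) + z) (sum-sub (f ∘ fs) (g ∘ fs)) ⟩
  (f fz - g fz) + (sum (f ∘ fs) - sum (g ∘ fs))
    ≡⟨ regroup (f fz) (g fz) (sum (f ∘ fs)) (sum (g ∘ fs)) ⟩
  (f fz + sum (f ∘ fs)) - (g fz + sum (g ∘ fs)) ∎
  where
  open ≡-Reasoning
  regroup : ∀ a b c d → (a - b) + (c - d) ≡ (a + c) - (b + d)
  regroup = solve-∀

sum-linear : ∀ {m} (a b : ℤ) (f g : Fin m → ℤ) → sum (λ i → a * f i + b * g i) ≡ a * sum f + b * sum g
sum-linear a b f g = trans (∑-distrib-+ (λ i → a * f i) (λ i → b * g i))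
  (sym (cong₂ _+_ (*-distribˡ-sum a f) (*-distribˡ-sum b g)))

sum-product : ∀ {m k} (f : Fin m → ℤ) (g : Fin k → ℤ) → sum f * sum g ≡ sum (λ i → sum (λ j → f i * g j))
sum-product f g = trans (*-distribʳ-sum (sum g) f) (sum-cong-≗ (λ i → *-distribˡ-sum (f i) g))

entry-from-total : ∀ {m} (f g : Fin m → ℤ) (j : Fin m) → (∀ i → i ≢ j → f i ≡ g i) →
                   f j ≡ sum f - sum g + g j
entry-from-total f g j agree = begin
  f j                                 ≡⟨ split (f j) (g j) ⟩
  (f j - g j) + g j                   ≡⟨ cong (_+ g j) (sym (sum-δ j (λ _ → f j - g j))) ⟩
  sum (λ i → δ j i * (f j - g j)) + g j ≡⟨ cong (_+ g j) (sum-cong-≗ localise) ⟩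
  sum (λ i → f i - g i) + g j         ≡⟨ cong (_+ g j) (sum-sub f g) ⟩
  sum f - sum g + g j ∎
  where
  open ≡-Reasoning
  split : ∀ a b → a ≡ (a - b) + b
  split = solve-∀
  localise : ∀ i → δ j i * (f j - g j) ≡ f i - g i
  localise i with j ≟ i
  ... | yes refl = *-identityˡ (f j - g j)
  ... | no j≢i   = trans (*-zeroˡ (f j - g j)) (sym (i≡j⇒i-j≡0 (agree i (j≢i ∘ sym))))

swap-factor : ∀ p q r → p * (q * r) ≡ q * (p * r)
swap-factor = solve-∀

sum-by-fibres : ∀ {m k} (c : Fin m → Fin k) (f : Fin k → Fin m → ℤ) →
                sum (λ a → f (c a) a) ≡ sum (λ h → sum (λ a → δ h (c a) * f h a))
sum-by-fibres c f = begin
  sum (λ a → f (c a) a)                       ≡⟨ sum-cong-≗ (λ a → sym (sum-δ (c a) (λ h → f h a))) ⟩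
  sum (λ a → sum (λ h → δ (c a) h * f h a))   ≡⟨ ∑-comm (λ a h → δ (c a) h * f h a) ⟩
  sum (λ h → sum (λ a → δ (c a) h * f h a))   ≡⟨ sum-cong-≗ (λ h → sum-cong-≗ (λ a → cong (_* f h a) (δ-sym (c a) h))) ⟩
  sum (λ h → sum (λ a → δ h (c a) * f h a)) ∎
  where open ≡-Reasoning

pull-out₂ : ∀ {p q r} (f : Fin p → Fin q → Fin r → ℤ) →
            sum (λ i → sum (λ x → sum (λ y → f i x y))) ≡ sum (λ x → sum (λ y → sum (λ i → f i x y)))
pull-out₂ f = trans (∑-comm (λ i x → sum (λ y → f i x y))) (sum-cong-≗ (λ x → ∑-comm (λ i y → f i x y)))

-- For an integer matrix E (rows x, columns a) consider the triple products
-- T(a,b,c) = Σ_x E_xa E_xb E_xc and the Gram matrix G(x,y) = Σ_a E_xa E_ya.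
module TripleProducts {m k : ℕ} (E : Fin m → Fin k → ℤ) where

  triple : Fin k → Fin k → Fin k → ℤ
  triple a b c = sum (λ x → E x a * E x b * E x c)

  gram : Fin m → Fin m → ℤ
  gram x y = sum (λ a → E x a * E y a)

  -- Σ_{a,b,c} T(a,b,c)² = Σ_{x,y} G(x,y)³: both expand to the same fivefold sum of
  -- H(a,b,c,x,y) = (E_xa E_ya)(E_xb E_yb)(E_xc E_yc).
  squares-of-triples : sum (λ a → sum (λ b → sum (λ c → triple a b c * triple a b c))) ≡
                       sum (λ x → sum (λ y → gram x y * (gram x y * gram x y)))
  squares-of-triples = begin
    sum (λ a → sum (λ b → sum (λ c → triple a b c * triple a b c)))
      ≡⟨ sum-cong-≗ (λ a → sum-cong-≗ (λ b → sum-cong-≗ (λ c → square a b c))) ⟩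
    sum (λ a → sum (λ b → sum (λ c → sum (λ x → sum (λ y → H a b c x y)))))
      ≡⟨ sum-cong-≗ (λ a → sum-cong-≗ (λ b → pull-out₂ (λ c x y → H a b c x y))) ⟩
    sum (λ a → sum (λ b → sum (λ x → sum (λ y → sum (λ c → H a b c x y)))))
      ≡⟨ sum-cong-≗ (λ a → pull-out₂ (λ b x y → sum (λ c → H a b c x y))) ⟩
    sum (λ a → sum (λ x → sum (λ y → sum (λ b → sum (λ c → H a b c x y)))))
      ≡⟨ pull-out₂ (λ a x y → sum (λ b → sum (λ c → H a b c x y))) ⟩
    sum (λ x → sum (λ y → sum (λ a → sum (λ b → sum (λ c → H a b c x y)))))
      ≡⟨ sum-cong-≗ (λ x → sum-cong-≗ (λ y → sym (cube x y))) ⟩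
    sum (λ x → sum (λ y → gram x y * (gram x y * gram x y))) ∎
    where
    open ≡-Reasoning
    H : Fin k → Fin k → Fin k → Fin m → Fin m → ℤ
    H a b c x y = (E x a * E y a) * ((E x b * E y b) * (E x c * E y c))

    regroup : ∀ p q r s t u → (p * q * r) * (s * t * u) ≡ (p * s) * ((q * t) * (r * u))
    regroup = solve-∀

    square : ∀ a b c → triple a b c * triple a b c ≡ sum (λ x → sum (λ y → H a b c x y))
    square a b c = trans (sum-product (λ x → E x a * E x b * E x c) (λ y → E y a * E y b * E y c))
      (sum-cong-≗ (λ x → sum-cong-≗ (λ y → regroup (E x a) (E x b) (E x c) (E y a) (E y b) (E y c))))

    cube : ∀ x y → gram x y * (gram x y * gram x y) ≡ sum (λ a → sum (λ b → sum (λ c → H a b c x y)))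
    cube x y = begin
      gram x y * (gram x y * gram x y)
        ≡⟨ cong (gram x y *_) (sum-product (λ b → E x b * E y b) (λ c → E x c * E y c)) ⟩
      gram x y * sum (λ b → sum (λ c → (E x b * E y b) * (E x c * E y c)))
        ≡⟨ sum-product (λ a → E x a * E y a) (λ b → sum (λ c → (E x b * E y b) * (E x c * E y c))) ⟩
      sum (λ a → sum (λ b → (E x a * E y a) * sum (λ c → (E x b * E y b) * (E x c * E y c))))
        ≡⟨ sum-cong-≗ (λ a → sum-cong-≗ (λ b → *-distribˡ-sum (E x a * E y a) (λ c → (E x b * E y b) * (E x c * E y c)))) ⟩
      sum (λ a → sum (λ b → sum (λ c → H a b c x y))) ∎

-- For a square matrix with G = κE whose rows have vanishing cube sums, every triple
-- product vanishes: Σ T² = κ³ Σ_{x,y} E_xy³ = 0 and a sum of squares is zero only termwise.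
triples-vanish : ∀ {m} (E : Fin m → Fin m → ℤ) (κ : ℤ) →
                 (∀ x y → TripleProducts.gram E x y ≡ κ * E x y) →
                 (∀ x → sum (λ a → E x a * (E x a * E x a)) ≡ 0ℤ) →
                 ∀ a b c → TripleProducts.triple E a b c ≡ 0ℤ
triples-vanish {m} E κ gram≡κE cubes a b c =
  square-zero (triple a b c)
    (sum-zero _ (λ c′ → square-nonneg (triple a b c′))
      (sum-zero _ (λ b′ → sum-nonneg _ (λ c′ → square-nonneg (triple a b′ c′)))
        (sum-zero _ (λ a′ → sum-nonneg _ (λ b′ → sum-nonneg _ (λ c′ → square-nonneg (triple a′ b′ c′))))
          total a) b) c)
  where
  open TripleProducts E
  scale : ∀ k e → (k * e) * ((k * e) * (k * e)) ≡ (k * (k * k)) * (e * (e * e))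
  scale = solve-∀
  total : sum (λ a → sum (λ b → sum (λ c → triple a b c * triple a b c))) ≡ 0ℤ
  total = begin
    sum (λ a → sum (λ b → sum (λ c → triple a b c * triple a b c)))
      ≡⟨ squares-of-triples ⟩
    sum (λ x → sum (λ y → gram x y * (gram x y * gram x y)))
      ≡⟨ sum-cong-≗ (λ x → sum-cong-≗ (λ y → trans (cong (λ g → g * (g * g)) (gram≡κE x y)) (scale κ (E x y)))) ⟩
    sum (λ x → sum (λ y → (κ * (κ * κ)) * (E x y * (E x y * E x y))))
      ≡⟨ sum-cong-≗ (λ x → trans (sym (*-distribˡ-sum (κ * (κ * κ)) (λ y → E x y * (E x y * E x y))))
                                 (trans (cong ((κ * (κ * κ)) *_) (cubes x)) (*-zeroʳ (κ * (κ * κ))))) ⟩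
    sum {m} (λ _ → 0ℤ)
      ≡⟨ sum-replicate-zero m ⟩
    0ℤ ∎
    where open ≡-Reasoning

∨-introˡ : ∀ {x} y → x ≡ true → x ∨ y ≡ true
∨-introˡ y refl = refl

∨-introʳ : ∀ x {y} → y ≡ true → x ∨ y ≡ true
∨-introʳ true  _ = refl
∨-introʳ false y = y

∨-elim : ∀ {x y} → x ∨ y ≡ true → x ≡ true ⊎ y ≡ true
∨-elim {true}  _ = inj₁ refl
∨-elim {false} y = inj₂ y

bool-cases : ∀ b → b ≡ true ⊎ b ≡ false
bool-cases true  = inj₁ refl
bool-cases false = inj₂ refl

not-both : ∀ {b} → b ≡ true → not b ≡ true → ⊥
not-both refl ()

∧-intro : ∀ {x y} → x ≡ true → y ≡ true → x ∧ y ≡ true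
∧-intro refl refl = refl

∧-elim : ∀ {x y} → x ∧ y ≡ true → x ≡ true × y ≡ true
∧-elim {true} {true} _ = refl , refl

anyFin-intro : ∀ {m} (f : Fin m → Bool) (i : Fin m) → f i ≡ true → anyFin f ≡ true
anyFin-intro f fz     fi = ∨-introˡ _ fi
anyFin-intro f (fs i) fi = ∨-introʳ (f fz) (anyFin-intro (f ∘ fs) i fi)

anyFin-elim : ∀ {m} (f : Fin m → Bool) → anyFin f ≡ true → ∃[ i ] f i ≡ true
anyFin-elim {suc m} f any with ∨-elim {f fz} any
... | inj₁ f0 = fz , f0
... | inj₂ rest with anyFin-elim (f ∘ fs) rest
...   | i , fi = fs i , fi

⌊≟⌋-sound : ∀ {m} {a b : Fin m} → ⌊ a ≟ b ⌋ ≡ true → a ≡ b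
⌊≟⌋-sound {a = a} {b} e with a ≟ b
... | yes a≡b = a≡b

⌊≟⌋-complete : ∀ {m} (a : Fin m) → ⌊ a ≟ a ⌋ ≡ true
⌊≟⌋-complete a with a ≟ a
... | yes _   = refl
... | no a≢a = ⊥-elim (a≢a refl)

Triangle : ℕ → ℕ → ℕ → Set
Triangle a b c = a ℕ.≤ b ℕ.+ c × b ℕ.≤ a ℕ.+ c × c ℕ.≤ a ℕ.+ b

triangle? : ∀ a b c → Dec (Triangle a b c)
triangle? a b c = (a ℕ.≤? b ℕ.+ c) ×-dec ((b ℕ.≤? a ℕ.+ c) ×-dec (c ℕ.≤? a ℕ.+ b))

module Distances (Γ : Graph) where
  open Graph Γ

  within-suc : ∀ k {u v} → within Γ k u v ≡ true → within Γ (suc k) u v ≡ true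
  within-suc k = ∨-introˡ _

  within-mono : ∀ {k l u v} → k ℕ.≤ l → within Γ k u v ≡ true → within Γ l u v ≡ true
  within-mono {k} {l} k≤l e with ℕP.≤⇒≤′ k≤l
  ... | ℕ.≤′-refl     = e
  ... | ℕ.≤′-step {n = l′} k≤l′ = within-suc l′ (within-mono (ℕP.≤′⇒≤ k≤l′) e)

  within-stepˡ : ∀ k {u w v} → adj u w ≡ true → within Γ k w v ≡ true → within Γ (suc k) u v ≡ true
  within-stepˡ k {u} {w} {v} uw wv =
    ∨-introʳ (within Γ k u v) (anyFin-intro (λ z → adj u z ∧ within Γ k z v) w (∧-intro uw wv))

  within-split : ∀ k {u v} → within Γ (suc k) u v ≡ true →
                 within Γ k u v ≡ true ⊎ ∃[ w ] (adj u w ≡ true × within Γ k w v ≡ true)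
  within-split k {u} {v} e with ∨-elim {within Γ k u v} e
  ... | inj₁ short = inj₁ short
  ... | inj₂ step with anyFin-elim (λ z → adj u z ∧ within Γ k z v) step
  ...   | w , uwv = inj₂ (w , ∧-elim {adj u w} uwv)

  within-stepʳ : ∀ k {u w v} → within Γ k u w ≡ true → adj w v ≡ true → within Γ (suc k) u v ≡ true
  within-stepʳ zero uw wv with ⌊≟⌋-sound uw
  ... | refl = within-stepˡ 0 wv (⌊≟⌋-complete _)
  within-stepʳ (suc k) uw wv with within-split k uw
  ... | inj₁ short        = within-suc (suc k) (within-stepʳ k short wv)
  ... | inj₂ (z , uz , zw) = within-stepˡ (suc k) uz (within-stepʳ k zw wv)

  within-sym : ∀ k {u v} → within Γ k u v ≡ true → within Γ k v u ≡ true
  within-sym zero e with ⌊≟⌋-sound e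
  ... | refl = e
  within-sym (suc k) {u} e with within-split k e
  ... | inj₁ short        = within-suc k (within-sym k short)
  ... | inj₂ (w , uw , wv) = within-stepʳ k (within-sym k wv) (trans (adj-sym w u) uw)

  within-trans : ∀ a b {x y z} → within Γ a x y ≡ true → within Γ b y z ≡ true → within Γ (a ℕ.+ b) x z ≡ true
  within-trans zero b xy yz with ⌊≟⌋-sound xy
  ... | refl = yz
  within-trans (suc a) b xy yz with within-split a xy
  ... | inj₁ short        = within-suc (a ℕ.+ b) (within-trans a b short yz)
  ... | inj₂ (w , xw , wy) = within-stepˡ (a ℕ.+ b) xw (within-trans a b wy yz)

  exact-distance : ∀ k {u v} → within Γ k u v ≡ true → ∃[ j ] (j ℕ.≤ k × atDist Γ j u v ≡ true)
  exact-distance zero e = 0 , z≤n , e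
  exact-distance (suc k) {u} {v} e with bool-cases (within Γ k u v)
  ... | inj₁ shorter = let (j , j≤k , at-j) = exact-distance k shorter in j , ℕP.m≤n⇒m≤1+n j≤k , at-j
  ... | inj₂ longer  = suc k , ℕP.≤-refl , ∧-intro e (cong not longer)

  atDist-within : ∀ j {u v} → atDist Γ j u v ≡ true → within Γ j u v ≡ true
  atDist-within zero    e = e
  atDist-within (suc j) e = proj₁ (∧-elim e)

  atDist-minimal : ∀ j {k u v} → atDist Γ j u v ≡ true → within Γ k u v ≡ true → j ℕ.≤ k
  atDist-minimal zero    _     _ = z≤n
  atDist-minimal (suc j) {k} {u} {v} exact bound with suc j ℕ.≤? k
  ... | yes j<k = j<k
  ... | no  j≮k = ⊥-elim (not-both (within-mono (ℕP.≤-pred (ℕP.≰⇒> j≮k)) bound)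
                                   (proj₂ (∧-elim {within Γ (suc j) u v} exact)))

  atDist-unique : ∀ i j {u v} → atDist Γ i u v ≡ true → atDist Γ j u v ≡ true → i ≡ j
  atDist-unique i j di dj = ℕP.≤-antisym (atDist-minimal i di (atDist-within j dj))
                                         (atDist-minimal j dj (atDist-within i di))

  atDist-triangle : ∀ a b c {x y z} → atDist Γ a x y ≡ true → atDist Γ b y z ≡ true →
                    atDist Γ c x z ≡ true → c ℕ.≤ a ℕ.+ b
  atDist-triangle a b c xy yz xz = atDist-minimal c xz (within-trans a b (atDist-within a xy) (atDist-within b yz))

  atDist-sym : ∀ j {u v} → atDist Γ j u v ≡ true → atDist Γ j v u ≡ true
  atDist-sym j {u} {v} e with exact-distance j (within-sym j (atDist-within j e))
  ... | i , i≤j , vu with atDist-minimal j e (within-sym i (atDist-within i vu))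
  ...   | j≤i = subst (λ k → atDist Γ k v u ≡ true) (ℕP.≤-antisym i≤j j≤i) vu

module Metric (Γ : Graph) (d : ℕ) (diameter : ∀ u v → within Γ d u v ≡ true) where
  open Graph Γ
  open Distances Γ

  exact : (u v : Fin n) → Σ[ j ∈ Fin (suc d) ] atDist Γ (toℕ j) u v ≡ true
  exact u v with exact-distance d (diameter u v)
  ... | j , j≤d , e = fromℕ< (s≤s j≤d) , subst (λ k → atDist Γ k u v ≡ true) (sym (toℕ-fromℕ< (s≤s j≤d))) e

  -- The distance, kept opaque: all its properties follow from dist-exact.
  opaque
    dist : Fin n → Fin n → Fin (suc d)
    dist u v = proj₁ (exact u v)

    dist-exact : ∀ u v → atDist Γ (toℕ (dist u v)) u v ≡ true
    dist-exact u v = proj₂ (exact u v)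

  atDist≡ : ∀ j u v → atDist Γ (toℕ j) u v ≡ ⌊ j ≟ dist u v ⌋
  atDist≡ j u v with j ≟ dist u v
  ... | yes refl = dist-exact u v
  ... | no j≢d with bool-cases (atDist Γ (toℕ j) u v)
  ...   | inj₁ e = ⊥-elim (j≢d (toℕ-injective (atDist-unique (toℕ j) (toℕ (dist u v)) e (dist-exact u v))))
  ...   | inj₂ e = e

  dist-sym : ∀ u v → dist u v ≡ dist v u
  dist-sym u v = toℕ-injective
    (atDist-unique (toℕ (dist u v)) (toℕ (dist v u)) (dist-exact u v) (atDist-sym (toℕ (dist v u)) (dist-exact v u)))

  dist-self : ∀ u → dist u u ≡ fz
  dist-self u = toℕ-injective (atDist-unique (toℕ (dist u u)) 0 (dist-exact u u) (⌊≟⌋-complete u))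

  δ-dist-zero : ∀ u v → δ fz (dist u v) ≡ δ u v
  δ-dist-zero u v = cong ⟦_⟧ (sym (atDist≡ fz u v))

  dist-triangle : ∀ x y z → Triangle (toℕ (dist x y)) (toℕ (dist x z)) (toℕ (dist y z))
  dist-triangle x y z =
      atDist-triangle ∣xz∣ ∣yz∣ ∣xy∣ (dist-exact x z) (atDist-sym ∣yz∣ (dist-exact y z)) (dist-exact x y)
    , atDist-triangle ∣xy∣ ∣yz∣ ∣xz∣ (dist-exact x y) (dist-exact y z) (dist-exact x z)
    , atDist-triangle ∣xy∣ ∣xz∣ ∣yz∣ (atDist-sym ∣xy∣ (dist-exact x y)) (dist-exact x z) (dist-exact y z)
    where
    ∣xy∣ ∣xz∣ ∣yz∣ : ℕ
    ∣xy∣ = toℕ (dist x y)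
    ∣xz∣ = toℕ (dist x z)
    ∣yz∣ = toℕ (dist y z)

  A : Fin (suc d) → (Fin n → ℤ) → Fin n → ℤ
  A j w x = sum (λ a → δ j (dist x a) * w a)

  valency : Fin (suc d) → Fin n → ℤ
  valency j = A j (λ _ → 1ℤ)

  A-zero : ∀ w x → A fz w x ≡ w x
  A-zero w x = trans (sum-cong-≗ (λ a → cong (_* w a) (δ-dist-zero x a))) (sum-δ x w)

  A-cong : ∀ j {w w′} → (∀ a → w a ≡ w′ a) → ∀ x → A j w x ≡ A j w′ x
  A-cong j w≗w′ x = sum-cong-≗ (λ a → cong (δ j (dist x a) *_) (w≗w′ a))

  A-scale : ∀ j c w x → A j (λ a → c * w a) x ≡ c * A j w x
  A-scale j c w x = trans (sum-cong-≗ (λ a → swap-factor (δ j (dist x a)) c (w a)))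
                          (sym (*-distribˡ-sum c (λ a → δ j (dist x a) * w a)))

  A-radial : ∀ i (π : Fin (suc d) → ℤ) {w} x → (∀ a → w a ≡ π (dist x a)) → A i w x ≡ π i * valency i x
  A-radial i π {w} x radial = begin
    sum (λ a → δ i (dist x a) * w a)             ≡⟨ sum-cong-≗ (λ a → cong (δ i (dist x a) *_) (radial a)) ⟩
    sum (λ a → δ i (dist x a) * π (dist x a))    ≡⟨ sum-cong-≗ (λ a → δ-subst π i (dist x a)) ⟩
    sum (λ a → δ i (dist x a) * π i)             ≡⟨ sum-cong-≗ (λ a → pull-constant (δ i (dist x a)) (π i)) ⟩
    sum (λ a → π i * (δ i (dist x a) * 1ℤ))      ≡⟨ sym (*-distribˡ-sum (π i) (λ a → δ i (dist x a) * 1ℤ)) ⟩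
    π i * valency i x ∎
    where
    open ≡-Reasoning
    pull-constant : ∀ e c → e * c ≡ c * (e * 1ℤ)
    pull-constant = solve-∀

  expand-by-distance : ∀ (g : Fin (suc d) → ℤ) w x → sum (λ a → g (dist x a) * w a) ≡ sum (λ h → g h * A h w x)
  expand-by-distance g w x = begin
    sum (λ a → g (dist x a) * w a)
      ≡⟨ sum-by-fibres (dist x) (λ h a → g h * w a) ⟩
    sum (λ h → sum (λ a → δ h (dist x a) * (g h * w a)))
      ≡⟨ sum-cong-≗ (λ h → trans (sum-cong-≗ (λ a → swap-factor (δ h (dist x a)) (g h) (w a)))
                                 (sym (*-distribˡ-sum (g h) (λ a → δ h (dist x a) * w a)))) ⟩
    sum (λ h → g h * A h w x) ∎
    where open ≡-Reasoning

  spectral-sum : ∀ (λs : Fin (suc d) → ℤ) w → (∀ h x → A h w x ≡ λs h * w x) →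
                 ∀ g x → sum (λ a → g (dist x a) * w a) ≡ sum (λ h → g h * λs h) * w x
  spectral-sum λs w eigen g x = begin
    sum (λ a → g (dist x a) * w a)       ≡⟨ expand-by-distance g w x ⟩
    sum (λ h → g h * A h w x)            ≡⟨ sum-cong-≗ (λ h → trans (cong (g h *_) (eigen h x)) (sym (*-assoc (g h) (λs h) (w x)))) ⟩
    sum (λ h → g h * λs h * w x)         ≡⟨ sym (*-distribʳ-sum (w x) (λ h → g h * λs h)) ⟩
    sum (λ h → g h * λs h) * w x ∎
    where open ≡-Reasoning

  -- N i j x y = #{a : d(x,a) = i, d(y,a) = j}; for d(x,y) = h this is p^h_{ij}.
  N : Fin (suc d) → Fin (suc d) → Fin n → Fin n → ℤ
  N i j x y = A i (λ a → δ j (dist y a)) x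

  N≡pCount : ∀ i j x y → + pCount Γ (toℕ i) (toℕ j) x y ≡ N i j x y
  N≡pCount i j x y = trans (count≡sum (λ a → atDist Γ (toℕ i) x a ∧ atDist Γ (toℕ j) y a)) (sum-cong-≗ λ a →
    trans (⟦∧⟧ (atDist Γ (toℕ i) x a) (atDist Γ (toℕ j) y a))
          (cong₂ (λ b c → ⟦ b ⟧ * ⟦ c ⟧) (atDist≡ i x a) (atDist≡ j y a)))

  N-swap : ∀ i j x y → N i j x y ≡ N j i y x
  N-swap i j x y = sum-cong-≗ (λ a → *-comm (δ i (dist x a)) (δ j (dist y a)))

  N-diag : ∀ i x → N i i x x ≡ valency i x
  N-diag i x = sum-cong-≗ (λ a → trans (δ-idem i (dist x a)) (sym (*-identityʳ (δ i (dist x a)))))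

  N-vanish : ∀ i j x y → ¬ Triangle (toℕ (dist x y)) (toℕ i) (toℕ j) → N i j x y ≡ 0ℤ
  N-vanish i j x y no-triangle = trans (sum-cong-≗ term) (sum-replicate-zero n)
    where
    term : ∀ a → δ i (dist x a) * δ j (dist y a) ≡ 0ℤ
    term a with i ≟ dist x a | j ≟ dist y a
    ... | yes refl | yes refl = ⊥-elim (no-triangle (dist-triangle x y a))
    ... | yes _    | no _     = refl
    ... | no _     | _        = *-zeroˡ (δ j (dist y a))

  N-row : ∀ i x y → sum (λ j → N i j x y) ≡ valency i x
  N-row i x y = begin
    sum (λ j → sum (λ a → δ i (dist x a) * δ j (dist y a)))
      ≡⟨ ∑-comm (λ j a → δ i (dist x a) * δ j (dist y a)) ⟩
    sum (λ a → sum (λ j → δ i (dist x a) * δ j (dist y a)))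
      ≡⟨ sum-cong-≗ (λ a → sym (*-distribˡ-sum (δ i (dist x a)) (λ j → δ j (dist y a)))) ⟩
    sum (λ a → δ i (dist x a) * sum (λ j → δ j (dist y a)))
      ≡⟨ sum-cong-≗ (λ a → cong (δ i (dist x a) *_) (partition (dist y a))) ⟩
    valency i x ∎
    where
    open ≡-Reasoning
    partition : ∀ c → sum (λ j → δ j c) ≡ 1ℤ
    partition c = trans (sum-cong-≗ (λ j → trans (δ-sym j c) (sym (*-identityʳ (δ c j))))) (sum-δ c (λ _ → 1ℤ))

  diagonal-from-row : ∀ (τ : Fin (suc d) → ℤ) i j x y → sum τ ≡ valency i x →
                      (∀ s → s ≢ j → N i s x y ≡ τ s) → N i j x y ≡ τ j
  diagonal-from-row τ i j x y total off = begin
    N i j x y                                         ≡⟨ entry-from-total (λ s → N i s x y) τ j off ⟩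
    sum (λ s → N i s x y) - sum τ + τ j              ≡⟨ cong (λ z → z - sum τ + τ j) (trans (N-row i x y) (sym total)) ⟩
    sum τ - sum τ + τ j                               ≡⟨ cancel (sum τ) (τ j) ⟩
    τ j ∎
    where
    open ≡-Reasoning
    cancel : ∀ a b → a - a + b ≡ b
    cancel = solve-∀

  product-rule : ∀ i j (π : Fin (suc d) → ℤ) → (∀ x a → N i j x a ≡ π (dist x a)) →
                 ∀ w x → A i (A j w) x ≡ sum (λ h → π h * A h w x)
  product-rule i j π p-table w x = begin
    sum (λ b → δ i (dist x b) * sum (λ a → δ j (dist b a) * w a))
      ≡⟨ sum-cong-≗ (λ b → *-distribˡ-sum (δ i (dist x b)) (λ a → δ j (dist b a) * w a)) ⟩
    sum (λ b → sum (λ a → δ i (dist x b) * (δ j (dist b a) * w a)))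
      ≡⟨ ∑-comm (λ b a → δ i (dist x b) * (δ j (dist b a) * w a)) ⟩
    sum (λ a → sum (λ b → δ i (dist x b) * (δ j (dist b a) * w a)))
      ≡⟨ sum-cong-≗ (λ a → trans (sum-cong-≗ (λ b → regroup a b)) (sym (*-distribʳ-sum (w a) (λ b → δ i (dist x b) * δ j (dist a b))))) ⟩
    sum (λ a → N i j x a * w a)
      ≡⟨ sum-cong-≗ (λ a → cong (_* w a) (p-table x a)) ⟩
    sum (λ a → π (dist x a) * w a)
      ≡⟨ expand-by-distance π w x ⟩
    sum (λ h → π h * A h w x) ∎
    where
    open ≡-Reasoning
    assoc : ∀ p q r → p * (q * r) ≡ p * q * r
    assoc = solve-∀
    regroup : ∀ a b → δ i (dist x b) * (δ j (dist b a) * w a) ≡ δ i (dist x b) * δ j (dist a b) * w a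
    regroup a b = trans (cong (λ c → δ i (dist x b) * (δ j c * w a)) (dist-sym b a)) (assoc (δ i (dist x b)) (δ j (dist a b)) (w a))

  double-count : ∀ i j l x → A i (λ a → N j l x a) x ≡ A j (λ b → N i l x b) x
  double-count i j l x = begin
    sum (λ a → δ i (dist x a) * sum (λ b → δ j (dist x b) * δ l (dist a b)))
      ≡⟨ sum-cong-≗ (λ a → *-distribˡ-sum (δ i (dist x a)) (λ b → δ j (dist x b) * δ l (dist a b))) ⟩
    sum (λ a → sum (λ b → δ i (dist x a) * (δ j (dist x b) * δ l (dist a b))))
      ≡⟨ ∑-comm (λ a b → δ i (dist x a) * (δ j (dist x b) * δ l (dist a b))) ⟩
    sum (λ b → sum (λ a → δ i (dist x a) * (δ j (dist x b) * δ l (dist a b))))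
      ≡⟨ sum-cong-≗ (λ b → sum-cong-≗ (λ a → trans (cong (λ c → δ i (dist x a) * (δ j (dist x b) * δ l c)) (dist-sym a b))
                                                   (swap-factor (δ i (dist x a)) (δ j (dist x b)) (δ l (dist b a))))) ⟩
    sum (λ b → sum (λ a → δ j (dist x b) * (δ i (dist x a) * δ l (dist b a))))
      ≡⟨ sum-cong-≗ (λ b → sym (*-distribˡ-sum (δ j (dist x b)) (λ a → δ i (dist x a) * δ l (dist b a)))) ⟩
    sum (λ b → δ j (dist x b) * sum (λ a → δ i (dist x a) * δ l (dist b a))) ∎
    where open ≡-Reasoning

  -- Hence k_i p^i_{jl} = k_j p^j_{il}.
  balance : ∀ i j l x (π ρ : Fin (suc d) → ℤ) → (∀ a → N j l x a ≡ π (dist x a)) → (∀ b → N i l x b ≡ ρ (dist x b)) →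
            π i * valency i x ≡ ρ j * valency j x
  balance i j l x π ρ π-table ρ-table =
    trans (sym (A-radial i π x π-table)) (trans (double-count i j l x) (A-radial j ρ x ρ-table))

  expand-by-pair : ∀ (g : Fin (suc d) → Fin (suc d) → ℤ) u v →
                   sum (λ a → g (dist u a) (dist v a)) ≡ sum (λ r → sum (λ s → g r s * N r s u v))
  expand-by-pair g u v = begin
    sum (λ a → g (dist u a) (dist v a))
      ≡⟨ sum-by-fibres (dist u) (λ r a → g r (dist v a)) ⟩
    sum (λ r → sum (λ a → δ r (dist u a) * g r (dist v a)))
      ≡⟨ sum-cong-≗ (λ r → trans (sum-cong-≗ (λ a → *-comm (δ r (dist u a)) (g r (dist v a))))
                                 (sum-by-fibres (dist v) (λ s a → g r s * δ r (dist u a)))) ⟩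
    sum (λ r → sum (λ s → sum (λ a → δ s (dist v a) * (g r s * δ r (dist u a)))))
      ≡⟨ sum-cong-≗ (λ r → sum-cong-≗ (λ s → trans (sum-cong-≗ (λ a → regroup (δ s (dist v a)) (g r s) (δ r (dist u a))))
                                                   (sym (*-distribˡ-sum (g r s) (λ a → δ r (dist u a) * δ s (dist v a)))))) ⟩
    sum (λ r → sum (λ s → g r s * N r s u v)) ∎
    where
    open ≡-Reasoning
    regroup : ∀ p q r → p * (q * r) ≡ q * (r * p)
    regroup = solve-∀

-- The numbers of the array {135,128,16; 1,16,120}, with k = 135, a_1 = 6, a_2 = 103,
-- a_3 = 15; all facts about them are checked by evaluation.

-- stepTable h j = p^h_{1j}.
stepTable : Fin 4 → Fin 4 → ℤ
stepTable = fromList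
  ( fromList (+ 0 ∷ + 135 ∷ + 0   ∷ + 0  ∷ [])
  ∷ fromList (+ 1 ∷ + 6   ∷ + 128 ∷ + 0  ∷ [])
  ∷ fromList (+ 0 ∷ + 16  ∷ + 103 ∷ + 16 ∷ [])
  ∷ fromList (+ 0 ∷ + 0   ∷ + 120 ∷ + 15 ∷ []) ∷ [])

-- The eigenvalues of A_0, …, A_3 on a common eigenvector on which A_1 acts as θ.
eigenvalues : ℤ → ℤ → ℤ → Fin 4 → ℤ
eigenvalues θ μ ν = fromList (1ℤ ∷ θ ∷ μ ∷ ν ∷ [])

-- The valencies k_0, …, k_3 (the eigenvalues on the all-ones vector).
valencies : Fin 4 → ℤ
valencies = eigenvalues (+ 135) (+ 1080) (+ 144)

-- edgeTable r s = p^1_{rs}.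
edgeTable : Fin 4 → Fin 4 → ℤ
edgeTable = fromList
  ( fromList (+ 0 ∷ + 1   ∷ + 0   ∷ + 0   ∷ [])
  ∷ fromList (+ 1 ∷ + 6   ∷ + 128 ∷ + 0   ∷ [])
  ∷ fromList (+ 0 ∷ + 128 ∷ + 824 ∷ + 128 ∷ [])
  ∷ fromList (+ 0 ∷ + 0   ∷ + 128 ∷ + 16  ∷ []) ∷ [])

-- F j = 27 u_j for the standard sequence (u_j) of the eigenvalue θ = -25.
F : Fin 4 → ℤ
F = fromList (+ 27 ∷ - (+ 5) ∷ + 1 ∷ - (+ 3) ∷ [])

-- The eigenvalues of A_0, …, A_3 on the θ = -25 eigenvectors.
θ-spectrum : Fin 4 → ℤ
θ-spectrum = eigenvalues (- (+ 25)) (+ 40) (- (+ 16))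

stepTable-rows : ∀ h → sum (stepTable h) ≡ + 135
stepTable-rows 0F = refl
stepTable-rows 1F = refl
stepTable-rows 2F = refl
stepTable-rows 3F = refl

edgeTable-rows : ∀ r → sum (edgeTable r) ≡ valencies r
edgeTable-rows 0F = refl
edgeTable-rows 1F = refl
edgeTable-rows 2F = refl
edgeTable-rows 3F = refl

F-recurrence : ∀ h → sum (λ j → F j * stepTable h j) ≡ - (+ 25) * F h
F-recurrence 0F = refl
F-recurrence 1F = refl
F-recurrence 2F = refl
F-recurrence 3F = refl

-- Σ_j F_j λ_j = 240, the multiplier in the Gram identity of the vectors F(d(x,·)).
F-gram-constant : sum (λ h → F h * θ-spectrum h) ≡ + 240
F-gram-constant = refl

-- Σ_j k_j F_j³ = 0: the Krein parameter q^θ_{θθ} vanishes.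
F-cubes : sum (λ h → F h * (F h * F h) * valencies h) ≡ 0ℤ
F-cubes = refl

-- Pair weights: 3 F_r F_s F_t equals G_rs + G_rt + G_st, up to the corner terms below,
-- on every triple of distances (r,s,t) of a vertex from the three vertices of a triangle.
pairWeight : Fin 4 → Fin 4 → ℤ
pairWeight = fromList
  ( fromList (+ 0   ∷ + 967   ∷ + 0     ∷ + 0     ∷ [])
  ∷ fromList (+ 967 ∷ + 91    ∷ - (+ 8) ∷ + 0     ∷ [])
  ∷ fromList (+ 0   ∷ - (+ 8) ∷ + 1     ∷ - (+ 5) ∷ [])
  ∷ fromList (+ 0   ∷ + 0     ∷ - (+ 5) ∷ + 37    ∷ []) ∷ [])

corner : Fin 4 → Fin 4 → Fin 4 → ℤ
corner r s t = + 27 * (δ 1F r * δ 1F s * δ 1F t) + + 8 * (δ 3F r * δ 3F s * δ 3F t)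

pairWeight-total : sum (λ r → sum (λ s → pairWeight r s * edgeTable r s)) ≡ + 568
pairWeight-total = refl

decomposition : ∀ r s t → Triangle 1 (toℕ r) (toℕ s) → Triangle 1 (toℕ r) (toℕ t) → Triangle 1 (toℕ s) (toℕ t) →
                + 3 * (F r * F s * F t) + + 24 * corner r s t ≡ pairWeight r s + pairWeight r t + pairWeight s t
decomposition = toWitness {a? = all? λ r → all? λ s → all? λ t →
  triangle? 1 (toℕ r) (toℕ s) →-dec (triangle? 1 (toℕ r) (toℕ t) →-dec (triangle? 1 (toℕ s) (toℕ t) →-dec
  (+ 3 * (F r * F s * F t) + + 24 * corner r s t ≟ℤ pairWeight r s + pairWeight r t + pairWeight s t)))} _

no-solutionℕ : ∀ a b → 27 ℕ.* a ℕ.+ 8 ℕ.* b ≢ 71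
no-solutionℕ 0 b e = toWitnessFalse {a? = 8 ∣? 71} _ (divides b (trans (sym e) (ℕP.*-comm 8 b)))
no-solutionℕ 1 b e = toWitnessFalse {a? = 8 ∣? 44} _ (divides b (trans (sym (ℕP.+-cancelˡ-≡ 27 (8 ℕ.* b) 44 e)) (ℕP.*-comm 8 b)))
no-solutionℕ 2 b e = toWitnessFalse {a? = 8 ∣? 17} _ (divides b (trans (sym (ℕP.+-cancelˡ-≡ 54 (8 ℕ.* b) 17 e)) (ℕP.*-comm 8 b)))
no-solutionℕ (suc (suc (suc a))) b e = toWitnessFalse {a? = 81 ℕ.≤? 71} _ (begin
  81                                     ≤⟨ ℕP.*-monoʳ-≤ 27 (s≤s (s≤s (s≤s z≤n))) ⟩
  27 ℕ.* (3 ℕ.+ a)                       ≤⟨ ℕP.m≤m+n _ (8 ℕ.* b) ⟩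
  27 ℕ.* (3 ℕ.+ a) ℕ.+ 8 ℕ.* b           ≡⟨ e ⟩
  71 ∎)
  where open ℕP.≤-Reasoning

no-solution : ∀ a b → 0ℤ ≤ a → 0ℤ ≤ b → + 27 * a + + 8 * b ≢ + 71
no-solution (+ a) (+ b) _ _ e = no-solutionℕ a b (+-injective (begin
  + (27 ℕ.* a ℕ.+ 8 ℕ.* b)       ≡⟨ pos-+ (27 ℕ.* a) (8 ℕ.* b) ⟩
  + (27 ℕ.* a) + + (8 ℕ.* b)     ≡⟨ cong₂ _+_ (pos-* 27 a) (pos-* 8 b) ⟩
  + 27 * + a + + 8 * + b         ≡⟨ e ⟩
  + 71 ∎))
  where open ≡-Reasoning

product-nonzero : ∀ a b → a * b ≢ 0ℤ → a ≢ 0ℤ × b ≢ 0ℤ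
product-nonzero a b ab≢0 = (λ a≡0 → ab≢0 (trans (cong (_* b) a≡0) (*-zeroˡ b)))
                         , (λ b≡0 → ab≢0 (trans (cong (a *_) b≡0) (*-zeroʳ a)))

not-triangle : ∀ a b c {_ : False (triangle? a b c)} → ¬ Triangle a b c
not-triangle a b c {no-triangle} = toWitnessFalse no-triangle

module ArrayConsequences
  (Γ : Graph) (diameter : ∀ u v → within Γ 3 u v ≡ true)
  (p : ℕ → ℕ → ℕ → ℕ)
  (p-count : ∀ h i j → h ℕ.≤ 3 → i ℕ.≤ 3 → j ℕ.≤ 3 →
             ∀ u v → atDist Γ h u v ≡ true → pCount Γ i j u v ≡ p h i j)
  (b-array : ∀ (i : Fin 3) → fromList (135 ∷ 128 ∷ 16 ∷ []) i ≡ p (toℕ i) 1 (suc (toℕ i)))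
  (c-array : ∀ (i : Fin 3) → fromList (1 ∷ 16 ∷ 120 ∷ []) i ≡ p (suc (toℕ i)) 1 (toℕ i))
  where
  open Graph Γ
  open Metric Γ 3 diameter

  N-intersection : ∀ i j x y → N i j x y ≡ + p (toℕ (dist x y)) (toℕ i) (toℕ j)
  N-intersection i j x y = trans (sym (N≡pCount i j x y))
    (cong +_ (p-count _ _ _ (toℕ≤pred[n] (dist x y)) (toℕ≤pred[n] i) (toℕ≤pred[n] j) x y (dist-exact x y)))

  N-at : ∀ x y h i j → dist x y ≡ h → N i j x y ≡ + p (toℕ h) (toℕ i) (toℕ j)
  N-at x y _ i j refl = N-intersection i j x y

  vanish-at : ∀ x y h i j → dist x y ≡ h → ¬ Triangle (toℕ h) (toℕ i) (toℕ j) → N i j x y ≡ 0ℤ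
  vanish-at x y _ i j refl = N-vanish i j x y

  degree : ∀ x → valency 1F x ≡ + 135
  degree x = trans (sym (N-diag 1F x)) (trans (N-at x x 0F 1F 1F (dist-self x)) (cong +_ (sym (b-array 0F))))

  -- p^h_{1j} off the diagonal: b_h and c_h from the array, 0 by the triangle inequality.
  step-off : ∀ x y h j → dist x y ≡ h → j ≢ h → N 1F j x y ≡ stepTable h j
  step-off x y 0F 0F xy j≢h = ⊥-elim (j≢h refl)
  step-off x y 0F 1F xy _   = trans (N-at x y 0F 1F 1F xy) (cong +_ (sym (b-array 0F)))
  step-off x y 0F 2F xy _   = vanish-at x y 0F 1F 2F xy (not-triangle 0 1 2)
  step-off x y 0F 3F xy _   = vanish-at x y 0F 1F 3F xy (not-triangle 0 1 3)
  step-off x y 1F 0F xy _   = trans (N-at x y 1F 1F 0F xy) (cong +_ (sym (c-array 0F)))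
  step-off x y 1F 1F xy j≢h = ⊥-elim (j≢h refl)
  step-off x y 1F 2F xy _   = trans (N-at x y 1F 1F 2F xy) (cong +_ (sym (b-array 1F)))
  step-off x y 1F 3F xy _   = vanish-at x y 1F 1F 3F xy (not-triangle 1 1 3)
  step-off x y 2F 0F xy _   = vanish-at x y 2F 1F 0F xy (not-triangle 2 1 0)
  step-off x y 2F 1F xy _   = trans (N-at x y 2F 1F 1F xy) (cong +_ (sym (c-array 1F)))
  step-off x y 2F 2F xy j≢h = ⊥-elim (j≢h refl)
  step-off x y 2F 3F xy _   = trans (N-at x y 2F 1F 3F xy) (cong +_ (sym (b-array 2F)))
  step-off x y 3F 0F xy _   = vanish-at x y 3F 1F 0F xy (not-triangle 3 1 0)
  step-off x y 3F 1F xy _   = vanish-at x y 3F 1F 1F xy (not-triangle 3 1 1)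
  step-off x y 3F 2F xy _   = trans (N-at x y 3F 1F 2F xy) (cong +_ (sym (c-array 2F)))
  step-off x y 3F 3F xy j≢h = ⊥-elim (j≢h refl)

  -- p^h_{1j} = stepTable h j; the diagonal a_h comes from b_h + a_h + c_h = k.
  step-counts : ∀ x y j → N 1F j x y ≡ stepTable (dist x y) j
  step-counts x y j with j ≟ dist x y
  ... | no j≢h   = step-off x y (dist x y) j refl j≢h
  ... | yes refl = diagonal-from-row (stepTable (dist x y)) 1F (dist x y) x y
                     (trans (stepTable-rows (dist x y)) (sym (degree x)))
                     (λ s s≢h → step-off x y (dist x y) s refl s≢h)

  recurrence : ∀ j w x → A 1F (A j w) x ≡ sum (λ h → stepTable h j * A h w x)
  recurrence j = product-rule 1F j (λ h → stepTable h j) (λ x a → step-counts x a j)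

  A-twice : ∀ w θ → (∀ x → A 1F w x ≡ θ * w x) → ∀ j λj → (∀ x → A j w x ≡ λj * w x) →
            ∀ x → A 1F (A j w) x ≡ λj * (θ * w x)
  A-twice w θ eigen j λj eigen-j x = begin
    A 1F (A j w) x             ≡⟨ A-cong 1F eigen-j x ⟩
    A 1F (λ a → λj * w a) x    ≡⟨ A-scale 1F λj w x ⟩
    λj * A 1F w x              ≡⟨ cong (λj *_) (eigen x) ⟩
    λj * (θ * w x) ∎
    where open ≡-Reasoning

  -- A A_1 = k A_0 + a_1 A_1 + c_2 A_2: an eigenvector of A_1 is one of A_2, with c_2 μ = θ² - a_1 θ - k.
  second-eigenvalue : ∀ w θ μ → (∀ x → A 1F w x ≡ θ * w x) → + 16 * μ ≡ θ * θ - + 6 * θ - + 135 →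
                      ∀ x → A 2F w x ≡ μ * w x
  second-eigenvalue w θ μ eigen μ-eq x = *-cancelˡ-≡ (+ 16) (A 2F w x) (μ * w x) (begin
    + 16 * A 2F w x
      ≡⟨ isolate (w x) θ (A 2F w x) (A 3F w x) ⟩
    (+ 135 * w x + (+ 6 * (θ * w x) + (+ 16 * A 2F w x + (+ 0 * A 3F w x + 0ℤ)))) - + 135 * w x - + 6 * (θ * w x)
      ≡⟨ cong (λ t → t - + 135 * w x - + 6 * (θ * w x)) expanded ⟩
    θ * (θ * w x) - + 135 * w x - + 6 * (θ * w x)
      ≡⟨ factor θ (w x) ⟩
    (θ * θ - + 6 * θ - + 135) * w x
      ≡⟨ cong (_* w x) (sym μ-eq) ⟩
    + 16 * μ * w x
      ≡⟨ *-assoc (+ 16) μ (w x) ⟩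
    + 16 * (μ * w x) ∎)
    where
    open ≡-Reasoning
    isolate : ∀ W t X Y → + 16 * X ≡ (+ 135 * W + (+ 6 * (t * W) + (+ 16 * X + (+ 0 * Y + 0ℤ)))) - + 135 * W - + 6 * (t * W)
    isolate = solve-∀
    factor : ∀ t W → t * (t * W) - + 135 * W - + 6 * (t * W) ≡ (t * t - + 6 * t - + 135) * W
    factor = solve-∀
    expanded : + 135 * w x + (+ 6 * (θ * w x) + (+ 16 * A 2F w x + (+ 0 * A 3F w x + 0ℤ))) ≡ θ * (θ * w x)
    expanded = begin
      + 135 * w x + (+ 6 * (θ * w x) + (+ 16 * A 2F w x + (+ 0 * A 3F w x + 0ℤ)))
        ≡⟨ cong₂ (λ a b → + 135 * a + (+ 6 * b + (+ 16 * A 2F w x + (+ 0 * A 3F w x + 0ℤ))))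
                 (sym (A-zero w x)) (sym (eigen x)) ⟩
      sum (λ h → stepTable h 1F * A h w x)   ≡⟨ sym (recurrence 1F w x) ⟩
      A 1F (A 1F w) x                         ≡⟨ A-twice w θ eigen 1F θ eigen x ⟩
      θ * (θ * w x) ∎

  -- A A_2 = b_1 A_1 + a_2 A_2 + c_3 A_3: then w is an eigenvector of A_3, with c_3 ν = μθ - b_1 θ - a_2 μ.
  third-eigenvalue : ∀ w θ μ ν → (∀ x → A 1F w x ≡ θ * w x) → (∀ x → A 2F w x ≡ μ * w x) →
                     + 120 * ν ≡ μ * θ - + 128 * θ - + 103 * μ → ∀ x → A 3F w x ≡ ν * w x
  third-eigenvalue w θ μ ν eigen eigen₂ ν-eq x = *-cancelˡ-≡ (+ 120) (A 3F w x) (ν * w x) (begin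
    + 120 * A 3F w x
      ≡⟨ isolate (w x) θ μ (A 3F w x) ⟩
    (+ 0 * w x + (+ 128 * (θ * w x) + (+ 103 * (μ * w x) + (+ 120 * A 3F w x + 0ℤ)))) - + 128 * (θ * w x) - + 103 * (μ * w x)
      ≡⟨ cong (λ t → t - + 128 * (θ * w x) - + 103 * (μ * w x)) expanded ⟩
    μ * (θ * w x) - + 128 * (θ * w x) - + 103 * (μ * w x)
      ≡⟨ factor θ μ (w x) ⟩
    (μ * θ - + 128 * θ - + 103 * μ) * w x
      ≡⟨ cong (_* w x) (sym ν-eq) ⟩
    + 120 * ν * w x
      ≡⟨ *-assoc (+ 120) ν (w x) ⟩
    + 120 * (ν * w x) ∎)
    where
    open ≡-Reasoning
    isolate : ∀ W t m X → + 120 * X ≡ (+ 0 * W + (+ 128 * (t * W) + (+ 103 * (m * W) + (+ 120 * X + 0ℤ)))) - + 128 * (t * W) - + 103 * (m * W)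
    isolate = solve-∀
    factor : ∀ t m W → m * (t * W) - + 128 * (t * W) - + 103 * (m * W) ≡ (m * t - + 128 * t - + 103 * m) * W
    factor = solve-∀
    substitute : ∀ {a a′ b b′ c c′} → a ≡ a′ → b ≡ b′ → c ≡ c′ →
                 + 0 * a + (+ 128 * b + (+ 103 * c + (+ 120 * A 3F w x + 0ℤ))) ≡
                 + 0 * a′ + (+ 128 * b′ + (+ 103 * c′ + (+ 120 * A 3F w x + 0ℤ)))
    substitute refl refl refl = refl
    expanded : + 0 * w x + (+ 128 * (θ * w x) + (+ 103 * (μ * w x) + (+ 120 * A 3F w x + 0ℤ))) ≡ μ * (θ * w x)
    expanded = begin
      + 0 * w x + (+ 128 * (θ * w x) + (+ 103 * (μ * w x) + (+ 120 * A 3F w x + 0ℤ)))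
        ≡⟨ substitute (sym (A-zero w x)) (sym (eigen x)) (sym (eigen₂ x)) ⟩
      sum (λ h → stepTable h 2F * A h w x)   ≡⟨ sym (recurrence 2F w x) ⟩
      A 1F (A 2F w) x                         ≡⟨ A-twice w θ eigen 2F μ eigen₂ x ⟩
      μ * (θ * w x) ∎

  eigen-extension : ∀ w θ μ ν → (∀ x → A 1F w x ≡ θ * w x) →
                    + 16 * μ ≡ θ * θ - + 6 * θ - + 135 → + 120 * ν ≡ μ * θ - + 128 * θ - + 103 * μ →
                    ∀ j x → A j w x ≡ eigenvalues θ μ ν j * w x
  eigen-extension w θ μ ν eigen μ-eq ν-eq 0F x = trans (A-zero w x) (sym (*-identityˡ (w x)))
  eigen-extension w θ μ ν eigen μ-eq ν-eq 1F x = eigen x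
  eigen-extension w θ μ ν eigen μ-eq ν-eq 2F x = second-eigenvalue w θ μ eigen μ-eq x
  eigen-extension w θ μ ν eigen μ-eq ν-eq 3F x =
    third-eigenvalue w θ μ ν eigen (second-eigenvalue w θ μ eigen μ-eq) ν-eq x

  -- The valencies: the all-ones vector is an eigenvector of A_1 with eigenvalue k.
  ones-spectrum : ∀ j x → A j (λ _ → 1ℤ) x ≡ valencies j * 1ℤ
  ones-spectrum = eigen-extension (λ _ → 1ℤ) (+ 135) (+ 1080) (+ 144)
                    (λ x → trans (degree x) (sym (*-identityʳ (+ 135)))) refl refl

  valency-values : ∀ j x → valency j x ≡ valencies j
  valency-values j x = trans (ones-spectrum j x) (*-identityʳ (valencies j))

  -- p^1_{23} = k_2 p^2_{13} / k_1 = 1080 · 16 / 135 = 128, by double counting.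
  distance-2-3 : ∀ u v → dist u v ≡ 1F → N 2F 3F u v ≡ + 128
  distance-2-3 u v uv = trans (N-at u v 1F 2F 3F uv) (*-cancelʳ-≡ (+ p 1 2 3) (+ 128) (+ 135) counted)
    where
    open ≡-Reasoning
    counted : + p 1 2 3 * + 135 ≡ + 128 * + 135
    counted = begin
      + p 1 2 3 * + 135            ≡⟨ cong (+ p 1 2 3 *_) (sym (valency-values 1F u)) ⟩
      + p 1 2 3 * valency 1F u     ≡⟨ balance 1F 2F 3F u (λ h → + p (toℕ h) 2 3) (λ h → stepTable h 3F)
                                             (λ a → N-intersection 2F 3F u a) (λ b → step-counts u b 3F) ⟩
      + 16 * valency 2F u          ≡⟨ cong (+ 16 *_) (valency-values 2F u) ⟩
      + 16 * + 1080                ≡⟨⟩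
      + 128 * + 135 ∎

  edge-off : ∀ u v → dist u v ≡ 1F → ∀ r s → r ≢ s → N r s u v ≡ edgeTable r s
  edge-off u v uv 0F 1F _ = trans (N-swap 0F 1F u v) (trans (step-counts v u 0F) (cong (λ h → stepTable h 0F) (trans (dist-sym v u) uv)))
  edge-off u v uv 0F 2F _ = vanish-at u v 1F 0F 2F uv (not-triangle 1 0 2)
  edge-off u v uv 0F 3F _ = vanish-at u v 1F 0F 3F uv (not-triangle 1 0 3)
  edge-off u v uv 1F s  _ = trans (step-counts u v s) (cong (λ h → stepTable h s) uv)
  edge-off u v uv 2F 0F _ = vanish-at u v 1F 2F 0F uv (not-triangle 1 2 0)
  edge-off u v uv 2F 1F _ = trans (N-swap 2F 1F u v) (trans (step-counts v u 2F) (cong (λ h → stepTable h 2F) (trans (dist-sym v u) uv)))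
  edge-off u v uv 2F 3F _ = distance-2-3 u v uv
  edge-off u v uv 3F 0F _ = vanish-at u v 1F 3F 0F uv (not-triangle 1 3 0)
  edge-off u v uv 3F 1F _ = vanish-at u v 1F 3F 1F uv (not-triangle 1 3 1)
  edge-off u v uv 3F 2F _ = trans (N-swap 3F 2F u v) (distance-2-3 v u (trans (dist-sym v u) uv))
  edge-off u v uv 0F 0F r≢s = ⊥-elim (r≢s refl)
  edge-off u v uv 2F 2F r≢s = ⊥-elim (r≢s refl)
  edge-off u v uv 3F 3F r≢s = ⊥-elim (r≢s refl)

  -- p^1_{rs} = edgeTable r s; the diagonal entries come from the valencies.
  edge-counts : ∀ u v → dist u v ≡ 1F → ∀ r s → N r s u v ≡ edgeTable r s
  edge-counts u v uv r s with s ≟ r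
  ... | no s≢r   = edge-off u v uv r s (s≢r ∘ sym)
  ... | yes refl = diagonal-from-row (edgeTable r) r r u v (trans (edgeTable-rows r) (sym (valency-values r u)))
                     (λ s′ s′≢r → edge-off u v uv r s′ (s′≢r ∘ sym))

  edge-weight : ∀ u v → dist u v ≡ 1F → sum (λ x → pairWeight (dist u x) (dist v x)) ≡ + 568
  edge-weight u v uv = trans (expand-by-pair pairWeight u v)
    (trans (sum-cong-≗ (λ r → sum-cong-≗ (λ s → cong (pairWeight r s *_) (edge-counts u v uv r s)))) pairWeight-total)

  E : Fin n → Fin n → ℤ
  E y a = F (dist y a)

  E-eigen : ∀ y x → A 1F (E y) x ≡ - (+ 25) * E y x
  E-eigen y x = begin
    sum (λ a → δ 1F (dist x a) * F (dist y a))
      ≡⟨ sum-cong-≗ (λ a → *-comm (δ 1F (dist x a)) (F (dist y a))) ⟩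
    sum (λ a → F (dist y a) * δ 1F (dist x a))
      ≡⟨ expand-by-distance F (λ a → δ 1F (dist x a)) y ⟩
    sum (λ h → F h * N h 1F y x)
      ≡⟨ sum-cong-≗ (λ h → cong (F h *_) (trans (N-swap h 1F y x) (step-counts x y h))) ⟩
    sum (λ h → F h * stepTable (dist x y) h)
      ≡⟨ F-recurrence (dist x y) ⟩
    - (+ 25) * F (dist x y)
      ≡⟨ cong (λ h → - (+ 25) * F h) (dist-sym x y) ⟩
    - (+ 25) * E y x ∎
    where open ≡-Reasoning

  E-spectrum : ∀ y j x → A j (E y) x ≡ θ-spectrum j * E y x
  E-spectrum y = eigen-extension (E y) (- (+ 25)) (+ 40) (- (+ 16)) (E-eigen y) refl refl

  E-gram : ∀ x y → TripleProducts.gram E x y ≡ + 240 * E x y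
  E-gram x y = begin
    sum (λ a → F (dist x a) * E y a)               ≡⟨ spectral-sum θ-spectrum (E y) (E-spectrum y) F x ⟩
    sum (λ h → F h * θ-spectrum h) * E y x         ≡⟨ cong₂ _*_ F-gram-constant (cong F (dist-sym y x)) ⟩
    + 240 * E x y ∎
    where open ≡-Reasoning

  -- Σ_a E_xa³ = Σ_j k_j F_j³ = 0
  E-cubes : ∀ x → sum (λ a → E x a * (E x a * E x a)) ≡ 0ℤ
  E-cubes x = begin
    sum (λ a → E x a * (E x a * E x a))
      ≡⟨ sum-cong-≗ (λ a → sym (*-identityʳ (E x a * (E x a * E x a)))) ⟩
    sum (λ a → F (dist x a) * (F (dist x a) * F (dist x a)) * 1ℤ)
      ≡⟨ spectral-sum valencies (λ _ → 1ℤ) ones-spectrum (λ h → F h * (F h * F h)) x ⟩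
    sum (λ h → F h * (F h * F h) * valencies h) * 1ℤ
      ≡⟨ cong (_* 1ℤ) F-cubes ⟩
    0ℤ ∎
    where open ≡-Reasoning

  krein : ∀ a b c → TripleProducts.triple E a b c ≡ 0ℤ
  krein = triples-vanish E (+ 240) E-gram E-cubes

  -- Summing the pointwise decomposition over all
  -- vertices x, the cubic terms vanish (krein) and each pair term contributes 568, so
  -- 24 (27 N₁ + 8 N₃) = 3 · 568, where N_i counts the vertices at distance i from u, v and w.
  module AroundTriangle (u v w : Fin n) (uv : dist u v ≡ 1F) (uw : dist u w ≡ 1F) (vw : dist v w ≡ 1F) where

    r s t : Fin n → Fin 4
    r = dist u
    s = dist v
    t = dist w

    corners : Fin 4 → ℤ
    corners i = sum (λ x → δ i (r x) * δ i (s x) * δ i (t x))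

    corners-nonneg : ∀ i → 0ℤ ≤ corners i
    corners-nonneg i = sum-nonneg (λ x → δ i (r x) * δ i (s x) * δ i (t x)) (λ x →
      nonneg-* (nonneg-* (δ-nonneg i (r x)) (δ-nonneg i (s x))) (δ-nonneg i (t x)))

    edge-triangle : ∀ a b x → dist a b ≡ 1F → Triangle 1 (toℕ (dist a x)) (toℕ (dist b x))
    edge-triangle a b x ab = subst (λ h → Triangle (toℕ h) (toℕ (dist a x)) (toℕ (dist b x))) ab (dist-triangle a b x)

    cubic : Fin n → ℤ
    cubic x = F (r x) * F (s x) * F (t x)

    cubic-sum : sum cubic ≡ 0ℤ
    cubic-sum = trans (sum-cong-≗ (λ x → cong₂ _*_ (cong₂ _*_ (cong F (dist-sym u x)) (cong F (dist-sym v x)))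
                                                    (cong F (dist-sym w x))))
                      (krein u v w)

    pair-sum : sum (λ x → pairWeight (r x) (s x) + pairWeight (r x) (t x) + pairWeight (s x) (t x)) ≡ + 568 + + 568 + + 568
    pair-sum = begin
      sum (λ x → pairWeight (r x) (s x) + pairWeight (r x) (t x) + pairWeight (s x) (t x))
        ≡⟨ ∑-distrib-+ (λ x → pairWeight (r x) (s x) + pairWeight (r x) (t x)) (λ x → pairWeight (s x) (t x)) ⟩
      sum (λ x → pairWeight (r x) (s x) + pairWeight (r x) (t x)) + sum (λ x → pairWeight (s x) (t x))
        ≡⟨ cong (_+ sum (λ x → pairWeight (s x) (t x))) (∑-distrib-+ (λ x → pairWeight (r x) (s x)) (λ x → pairWeight (r x) (t x))) ⟩
      sum (λ x → pairWeight (r x) (s x)) + sum (λ x → pairWeight (r x) (t x)) + sum (λ x → pairWeight (s x) (t x))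
        ≡⟨ cong₂ _+_ (cong₂ _+_ (edge-weight u v uv) (edge-weight u w uw)) (edge-weight v w vw) ⟩
      + 568 + + 568 + + 568 ∎
      where open ≡-Reasoning

    counting : + 27 * corners 1F + + 8 * corners 3F ≡ + 71
    counting = *-cancelˡ-≡ (+ 24) (+ 27 * corners 1F + + 8 * corners 3F) (+ 71) (begin
      + 24 * (+ 27 * corners 1F + + 8 * corners 3F)
        ≡⟨ cong (+ 24 *_) (sym (sum-linear (+ 27) (+ 8) (λ x → δ 1F (r x) * δ 1F (s x) * δ 1F (t x))
                                                          (λ x → δ 3F (r x) * δ 3F (s x) * δ 3F (t x)))) ⟩
      + 24 * sum corner-term
        ≡⟨ sym (+-identityˡ _) ⟩
      + 3 * 0ℤ + + 24 * sum corner-term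
        ≡⟨ cong (λ z → + 3 * z + + 24 * sum corner-term) (sym cubic-sum) ⟩
      + 3 * sum cubic + + 24 * sum corner-term
        ≡⟨ sym (sum-linear (+ 3) (+ 24) cubic corner-term) ⟩
      sum (λ x → + 3 * cubic x + + 24 * corner-term x)
        ≡⟨ sum-cong-≗ (λ x → decomposition (r x) (s x) (t x) (edge-triangle u v x uv) (edge-triangle u w x uw) (edge-triangle v w x vw)) ⟩
      sum (λ x → pairWeight (r x) (s x) + pairWeight (r x) (t x) + pairWeight (s x) (t x))
        ≡⟨ pair-sum ⟩
      + 24 * + 71 ∎)
      where
      open ≡-Reasoning
      corner-term : Fin n → ℤ
      corner-term x = corner (r x) (s x) (t x)

  no-triangle : ∀ u v w → dist u v ≡ 1F → dist u w ≡ 1F → dist v w ≡ 1F → ⊥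
  no-triangle u v w uv uw vw =
    no-solution (corners 1F) (corners 3F) (corners-nonneg 1F) (corners-nonneg 3F) counting
    where open AroundTriangle u v w uv uw vw

  -- Every vertex has a neighbour, as k = 135 > 0.
  neighbour : ∀ u → ∃[ v ] dist u v ≡ 1F
  neighbour u with sum-witness (λ v → δ 1F (dist u v) * 1ℤ) (λ k≡0 → k≢0 (trans (sym (degree u)) k≡0))
    where
    k≢0 : + 135 ≢ 0ℤ
    k≢0 ()
  ... | v , u~v = v , sym (δ-nonzero (proj₁ (product-nonzero _ _ u~v)))

  -- Adjacent vertices have a common neighbour, as a_1 = 6 > 0.
  common-neighbour : ∀ u v → dist u v ≡ 1F → ∃[ w ] (dist u w ≡ 1F × dist v w ≡ 1F)
  common-neighbour u v uv with sum-witness (λ w → δ 1F (dist u w) * δ 1F (dist v w)) (λ a₁≡0 → a₁≢0 (trans (sym a₁) a₁≡0))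
    where
    a₁ : N 1F 1F u v ≡ + 6
    a₁ = trans (step-counts u v 1F) (cong (λ h → stepTable h 1F) uv)
    a₁≢0 : + 6 ≢ 0ℤ
    a₁≢0 ()
  ... | w , uv~w = let (u~w , v~w) = product-nonzero _ _ uv~w in w , sym (δ-nonzero u~w) , sym (δ-nonzero v~w)

theorem4 : (Γ : Graph) →
    DRGWithArray Γ 3 (fromList (135 ∷ 128 ∷ 16 ∷ [])) (fromList (1 ∷ 16 ∷ 120 ∷ [])) → ⊥
theorem4 Γ ((diameter , u , _) , p , p-count , b-array , c-array) =
  let (v , uv)       = neighbour u
      (w , uw , vw)  = common-neighbour u v uv
  in  no-triangle u v w uv uw vw
  where open ArrayConsequences Γ diameter p p-count b-array c-array
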